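{- Let $(G,\sigma)$ be an unbalanced signed graph with a pendant vertex $u$ whose unique neighbour $v$ lies on a cycle of $G$. Then $$\eta(G,\sigma)\leq |V(G)|-2m(G)+2c(G)-2.$$
   Context: All graphs are finite and simple (not necessarily connected). A signed graph $(G,\sigma)$ is a graph $G$ with a map $\sigma:E(G)\to\{+,-\}$; its adjacency matrix $A(G,\sigma)$ has $(i,j)$-entry $\sigma(v_iv_j)$ if $v_iv_j\in E(G)$ and $0$ otherwise. The nullity $\eta(G,\sigma)$ is the multiplicity of $0$ as an eigenvalue of $A(G,\sigma)$. The sign of a cycle is the product of its edge signs; $(G,\sigma)$ is unbalanced if some cycle is negative. A pendant vertex is a vertex of degree one. $m(G)$ is the matching number and $c(G)=|E(G)|-|V(G)|+\theta(G)$, where $\theta(G)$ is the number of connected components. -}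

module Defs where

open import Data.Nat as ℕ using (ℕ; zero; suc; _<ᵇ_)
open import Data.Integer as ℤ using (ℤ)
open import Data.Rational as ℚ using (ℚ; 0ℚ; 1ℚ)
open import Data.Fin using (Fin; toℕ) renaming (zero to fzero; suc to fsuc)
open import Data.Bool using (Bool; true; false; if_then_else_; _∧_)
open import Data.Sign as Sign using (Sign)
open import Data.List using (List; []; _∷_; _++_; [_]; length; concatMap)
open import Data.List.Relation.Unary.All using (All)
open import Data.List.Relation.Unary.Unique.Propositional using (Unique)
open import Data.List.Membership.Propositional using (_∈_)
open import Data.Product using (Σ; ∃; _×_; _,_; proj₁; proj₂)
open import Relation.Binary.PropositionalEquality using (_≡_)

-- A finite simple signed graph on vertex set Fin n.
-- adj i j = true  iff  ij is an edge; sgn i j is the sign of that edge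
-- (only meaningful when adj i j = true).
record SignedGraph (n : ℕ) : Set where
  field
    adj     : Fin n → Fin n → Bool
    sgn     : Fin n → Fin n → Sign
    adj-sym : ∀ i j → adj i j ≡ adj j i
    sgn-sym : ∀ i j → sgn i j ≡ sgn j i
    irrefl  : ∀ i → adj i i ≡ false
open SignedGraph public

module _ {n : ℕ} (G : SignedGraph n) where

  Edge : Fin n → Fin n → Set
  Edge i j = adj G i j ≡ true

  countF : ∀ {k} → (Fin k → Bool) → ℕ
  countF {zero}  f = 0
  countF {suc k} f = (if f fzero then 1 else 0) ℕ.+ countF (λ i → f (fsuc i))

  sumℕ : ∀ {k} → (Fin k → ℕ) → ℕ
  sumℕ {zero}  f = 0
  sumℕ {suc k} f = f fzero ℕ.+ sumℕ (λ i → f (fsuc i))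

  degree : Fin n → ℕ
  degree i = countF (adj G i)

  Pendant : Fin n → Set
  Pendant u = degree u ≡ 1

  edgeCount : ℕ
  edgeCount = sumℕ (λ i → countF (λ j → adj G i j ∧ (toℕ i <ᵇ toℕ j)))

  pairs : List (Fin n) → List (Fin n × Fin n)
  pairs (x ∷ y ∷ ys) = (x , y) ∷ pairs (y ∷ ys)
  pairs _            = []

  cycEdges : List (Fin n) → List (Fin n × Fin n)
  cycEdges []       = []
  cycEdges (x ∷ xs) = pairs (x ∷ xs ++ [ x ])

  IsCycle : List (Fin n) → Set
  IsCycle cs = Unique cs × (3 ℕ.≤ length cs) × All (λ e → Edge (proj₁ e) (proj₂ e)) (cycEdges cs)

  signProd : List (Fin n × Fin n) → Sign
  signProd []            = Sign.+
  signProd ((a , b) ∷ es) = sgn G a b Sign.* signProd es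

  cycleSign : List (Fin n) → Sign
  cycleSign cs = signProd (cycEdges cs)

  Unbalanced : Set
  Unbalanced = Σ (List (Fin n)) λ cs → IsCycle cs × cycleSign cs ≡ Sign.-

  OnCycle : Fin n → Set
  OnCycle v = Σ (List (Fin n)) λ cs → IsCycle cs × v ∈ cs

  matchedVertices : List (Fin n × Fin n) → List (Fin n)
  matchedVertices = concatMap (λ e → proj₁ e ∷ proj₂ e ∷ [])

  IsMatching : List (Fin n × Fin n) → Set
  IsMatching M = All (λ e → Edge (proj₁ e) (proj₂ e)) M × Unique (matchedVertices M)

  IsMatchingNumber : ℕ → Set
  IsMatchingNumber m =
    (Σ (List (Fin n × Fin n)) λ M → IsMatching M × length M ≡ m) ×
    (∀ M → IsMatching M → length M ℕ.≤ m)

  data Walk : Fin n → Fin n → Set where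
    here : ∀ a → Walk a a
    step : ∀ {a b c} → Edge a b → Walk b c → Walk a c

  IsComponentCount : ℕ → Set
  IsComponentCount t = Σ (List (Fin n)) λ reps →
    length reps ≡ t × Unique reps ×
    (∀ r s → r ∈ reps → s ∈ reps → Walk r s → r ≡ s) ×
    (∀ v → Σ (Fin n) λ r → r ∈ reps × Walk v r)

  signℚ : Sign → ℚ
  signℚ Sign.+ = 1ℚ
  signℚ Sign.- = ℚ.- 1ℚ

  A : Fin n → Fin n → ℚ
  A i j = if adj G i j then signℚ (sgn G i j) else 0ℚ

  sumℚ : ∀ {k} → (Fin k → ℚ) → ℚ
  sumℚ {zero}  f = 0ℚ
  sumℚ {suc k} f = f fzero ℚ.+ sumℚ (λ i → f (fsuc i))

  InKernel : (Fin n → ℚ) → Set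
  InKernel x = ∀ i → sumℚ (λ j → A i j ℚ.* x j) ≡ 0ℚ

  LinIndep : ∀ {k} → (Fin k → Fin n → ℚ) → Set
  LinIndep {k} vs = ∀ (c : Fin k → ℚ) →
    (∀ j → sumℚ (λ i → c i ℚ.* vs i j) ≡ 0ℚ) → ∀ i → c i ≡ 0ℚ

  -- η is the nullity: the dimension of the null space of A(G,σ)
  -- (= multiplicity of eigenvalue 0, A being symmetric)
  IsNullity : ℕ → Set
  IsNullity η =
    (Σ (Fin η → Fin n → ℚ) λ vs → (∀ i → InKernel (vs i)) × LinIndep vs) ×
    (∀ k (vs : Fin k → Fin n → ℚ) → (∀ i → InKernel (vs i)) → LinIndep vs → k ℕ.≤ η)

-- Let y follow v on a cycle through v, let F be a breadth-first spanning forest of G − vy (it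
-- still spans every component, so |F| ≥ n − θ(G)), and let M be a matching. Call a vertex inner if it
-- is neither u nor v, and let T consist of the inner vertices that are incident with a non-forest
-- edge between inner vertices, or that are not an end of a forest edge of M between inner vertices.
-- A kernel vector x vanishing on T vanishes: x v = 0 by the row of u, and every other vertex is
-- forced to 0 by the row of an end of a forest edge of M (descending, then ascending induction on
-- depth). Hence η ≤ |T|. Charging each vertex of T to itself if it is unmatched, to an incident
-- inner non-forest edge, or to the unmatched vertex u if it is matched to v, gives
-- |T| ≤ (n − 2|M|) + (2(|E| − |F|) − 2), the −2 coming from the non-forest edge vy, which is not
-- between inner vertices.

module Submission where

open import Defs
open import Algebra.Bundles using (Ring)
import Algebra.Properties.Semiring.Sum as SemiringSum
open import Data.Bool using (Bool; true; false; if_then_else_; _∧_; _∨_; not; T)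
open import Data.Empty using (⊥)
open import Data.Fin using (Fin; zero; suc; toℕ; punchIn; punchOut)
import Data.Fin.Properties as FinP
open import Data.Nat as ℕ using (ℕ; zero; suc; z≤n; s≤s)
open import Data.Nat.Induction using (<-wellFounded)
import Induction.WellFounded as WF
import Relation.Binary.Construct.On as On
import Data.Nat.Properties as ℕP
open import Data.List using (List; []; _∷_; _++_; [_]; length)
open import Data.List.Properties using (++-identityʳ; ++-assoc)
import Data.List.Relation.Unary.All.Properties as AllP
open import Data.List.Membership.Propositional.Properties using (∈-∃++)
open import Data.List.Relation.Binary.Permutation.Propositional using (_↭_; ↭-trans; prep; ↭⇒↭ₛ)
import Data.List.Relation.Binary.Permutation.Propositional.Properties as PermP
open PermP using (shift; ↭-length)
import Data.List.Relation.Binary.Permutation.Setoid.Properties as PermS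
open import Data.List.Membership.Propositional using (_∈_; _∉_)
import Data.List.Relation.Unary.Any as Any
import Data.List.Relation.Unary.All as All
open All using (All; []; _∷_)
open AllP using (All¬⇒¬Any)
open import Data.List.Relation.Unary.AllPairs using ([]; _∷_)
open import Data.List.Relation.Unary.Unique.Propositional using (Unique)
open import Data.Product using (∃; _×_; _,_; proj₁; proj₂)
open import Data.Product.Properties using (≡-dec)
import Data.Sum
open Data.Sum using (_⊎_; inj₁; inj₂)
open import Data.Maybe as Maybe using (Maybe; just; nothing)
import Data.Maybe.Properties as MaybeP
open MaybeP using (just-injective)
import Relation.Binary.Construct.Closure.ReflexiveTransitive as Star
open Star using (Star; ε; _◅_; _◅◅_)
open import Data.Rational as ℚ using (ℚ; 0ℚ; 1ℚ)
import Data.Rational.Properties as ℚP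
open import Data.Rational.Solver using (module +-*-Solver)
open import Function using (_∘_; mk⇔)
open import Data.Nat.Tactic.RingSolver using (solve-∀)
open import Relation.Binary.PropositionalEquality hiding ([_])
import Data.Sign as Sign
open import Data.Bool.Properties using (∧-conicalˡ; ∧-conicalʳ; ∧-zeroʳ; ∨-zeroʳ)
open import Relation.Nullary using (¬_; Dec; yes; no; does)
open import Relation.Nullary.Decidable
  using (dec-true; dec-false; decidable-stable; ¬?; _⊎-dec_; _×-dec_; dec⇒maybe; does-⇔)
open import Relation.Nullary.Negation using (contradiction)

module ℚ∑ = SemiringSum (Ring.semiring ℚP.+-*-ring)
module ℕ∑ = SemiringSum ℕP.+-*-semiring
open ℚ∑ using (sum-syntax)

-- Counting

module _ where

  open import Data.Nat using (_+_; _≤_; _<_)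

  indicator : Bool → ℕ
  indicator b = if b then 1 else 0

  indicator-pos : ∀ {b} → b ≡ true → 0 < indicator b
  indicator-pos refl = s≤s z≤n

  count : ∀ {k} → (Fin k → Bool) → ℕ
  count f = ℕ∑.sum (indicator ∘ f)

  sum-mono-≤ : ∀ {k} {f g : Fin k → ℕ} → (∀ i → f i ≤ g i) → ℕ∑.sum f ≤ ℕ∑.sum g
  sum-mono-≤ {zero}  le = z≤n
  sum-mono-≤ {suc k} le = ℕP.+-mono-≤ (le zero) (sum-mono-≤ (le ∘ suc))

  ≤-sum : ∀ {k} (f : Fin k → ℕ) i → f i ≤ ℕ∑.sum f
  ≤-sum f zero    = ℕP.m≤m+n (f zero) _
  ≤-sum f (suc i) = ℕP.m≤n⇒m≤o+n (f zero) (≤-sum (f ∘ suc) i)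

  count-cong : ∀ {k} {f g : Fin k → Bool} → (∀ i → f i ≡ g i) → count f ≡ count g
  count-cong eq = ℕ∑.sum-cong-≗ (cong indicator ∘ eq)

  count-≤-sum : ∀ {k} (f : Fin k → Bool) (g : Fin k → ℕ) → (∀ i → f i ≡ true → 0 < g i) →
                count f ≤ ℕ∑.sum g
  count-≤-sum f g pos = sum-mono-≤ pointwise
    where
      pointwise : ∀ i → indicator (f i) ≤ g i
      pointwise i with f i in fi
      ... | true  = pos i fi
      ... | false = z≤n

  count-mono : ∀ {k} {f g : Fin k → Bool} → (∀ i → f i ≡ true → g i ≡ true) → count f ≤ count g
  count-mono {f = f} {g} f⊆g = count-≤-sum f (indicator ∘ g) (λ i fi → indicator-pos (f⊆g i fi))

  count-false : ∀ k → count {k} (λ _ → false) ≡ 0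
  count-false zero    = refl
  count-false (suc k) = count-false k

  count-∨-disjoint : ∀ {k} (f g : Fin k → Bool) → (∀ i → f i ≡ true → g i ≡ false) →
                     count (λ i → f i ∨ g i) ≡ count f + count g
  count-∨-disjoint f g disjoint =
    trans (ℕ∑.sum-cong-≗ pointwise) (ℕ∑.∑-distrib-+ (indicator ∘ f) (indicator ∘ g))
    where
      pointwise : ∀ i → indicator (f i ∨ g i) ≡ indicator (f i) + indicator (g i)
      pointwise i with f i in fi | g i in gi
      ... | true  | true  = contradiction (trans (sym gi) (disjoint i fi)) λ ()
      ... | true  | false = refl
      ... | false | _     = refl

  count-split : ∀ {k} (f g : Fin k → Bool) →
                count f ≡ count (λ i → f i ∧ g i) + count (λ i → f i ∧ not (g i))
  count-split f g = trans (count-cong pointwise) (count-∨-disjoint _ _ disjoint)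
    where
      pointwise : ∀ i → f i ≡ (f i ∧ g i) ∨ (f i ∧ not (g i))
      pointwise i with f i | g i
      ... | false | _     = refl
      ... | true  | true  = refl
      ... | true  | false = refl
      disjoint : ∀ i → f i ∧ g i ≡ true → f i ∧ not (g i) ≡ false
      disjoint i with f i | g i
      ... | true  | true  = λ _ → refl
      ... | false | _     = λ ()
      ... | true  | false = λ ()

  count-not : ∀ {k} (f : Fin k → Bool) → count f + count (not ∘ f) ≡ k
  count-not {zero}  f = refl
  count-not {suc k} f with f zero | count-not (f ∘ suc)
  ... | true  | eq = cong suc eq
  ... | false | eq = trans (ℕP.+-suc _ _) (cong suc eq)

  does-true⇒ : ∀ {p} {P : Set p} (P? : Dec P) → does P? ≡ true → P
  does-true⇒ (yes p) _ = p

  count-≟ : ∀ {k} (a : Fin k) → count (λ i → does (i FinP.≟ a)) ≡ 1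
  count-≟ {suc k} zero    = cong suc (count-false k)
  count-≟ {suc k} (suc a) = count-≟ a

  count-< : ∀ {k} {f g : Fin k → Bool} (a : Fin k) → (∀ i → f i ≡ true → g i ≡ true) →
            f a ≡ false → g a ≡ true → count f < count g
  count-< {f = f} {g} a f⊆g fa ga = begin-strict
    count f                                    <⟨ ℕP.m<m+n (count f) (s≤s z≤n) ⟩
    count f + 1                                ≡⟨ cong (count f +_) (count-≟ a) ⟨
    count f + count (λ i → does (i FinP.≟ a))  ≡⟨ count-∨-disjoint f _ a-only ⟨
    count (λ i → f i ∨ does (i FinP.≟ a))      ≤⟨ count-mono f∨a⊆g ⟩
    count g                                    ∎
    where
      open ℕP.≤-Reasoning
      a-only : ∀ i → f i ≡ true → does (i FinP.≟ a) ≡ false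
      a-only i fi = dec-false (i FinP.≟ a) λ { refl → contradiction (trans (sym fa) fi) λ () }
      f∨a⊆g : ∀ i → f i ∨ does (i FinP.≟ a) ≡ true → g i ≡ true
      f∨a⊆g i with f i in fi | i FinP.≟ a
      ... | true  | _        = λ _ → f⊆g i fi
      ... | false | yes refl = λ _ → ga

  count-pos : ∀ {k} {f : Fin k → Bool} (a : Fin k) → f a ≡ true → 0 < count f
  count-pos {k} {f} a fa = subst (_< count f) (count-false k) (count-< {f = λ _ → false} a (λ _ ()) refl fa)

  count-≤1 : ∀ {k} (f : Fin k → Bool) → (∀ i j → f i ≡ true → f j ≡ true → i ≡ j) → count f ≤ 1
  count-≤1 {k} f unique with FinP.any? (λ i → f i Data.Bool.≟ true)
  ... | yes (a , fa) = begin
    count f                          ≤⟨ count-mono (λ i fi → dec-true (i FinP.≟ a) (unique i a fi fa)) ⟩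
    count (λ i → does (i FinP.≟ a))  ≡⟨ count-≟ a ⟩
    1                                ∎
    where open ℕP.≤-Reasoning
  ... | no ∄a = ℕP.≤-trans (ℕP.≤-reflexive (trans (count-cong none) (count-false k))) z≤n
    where
      none : ∀ i → f i ≡ false
      none i with f i in fi
      ... | true  = contradiction (i , fi) ∄a
      ... | false = refl

  _∈?_ : ∀ {k} (i : Fin k) (xs : List (Fin k)) → Dec (i ∈ xs)
  i ∈? xs = Any.any? (i FinP.≟_) xs

  count-∈ : ∀ {k} (xs : List (Fin k)) → Unique xs → count (λ i → does (i ∈? xs)) ≡ length xs
  count-∈ {k} []       []           = count-false k
  count-∈     (x ∷ xs) (x∉xs ∷ !xs) = begin
    count (λ i → does (i FinP.≟ x) ∨ does (i ∈? xs))
      ≡⟨ count-∨-disjoint _ _ fresh ⟩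
    count (λ i → does (i FinP.≟ x)) + count (λ i → does (i ∈? xs))
      ≡⟨ cong₂ _+_ (count-≟ x) (count-∈ xs !xs) ⟩
    suc (length xs) ∎
    where
      open ≡-Reasoning
      fresh : ∀ i → does (i FinP.≟ x) ≡ true → does (i ∈? xs) ≡ false
      fresh i i≡x with i FinP.≟ x
      ... | yes refl = dec-false (i ∈? xs) (All¬⇒¬Any x∉xs)

  module _ {n} (G : SignedGraph n) where

    countF≡count : ∀ {k} (f : Fin k → Bool) → countF G f ≡ count f
    countF≡count {zero}  f = refl
    countF≡count {suc k} f = cong (indicator (f zero) +_) (countF≡count (f ∘ suc))

    sumℕ≡sum : ∀ {k} (f : Fin k → ℕ) → sumℕ G f ≡ ℕ∑.sum f
    sumℕ≡sum {zero}  f = refl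
    sumℕ≡sum {suc k} f = cong (f zero +_) (sumℕ≡sum (f ∘ suc))

    sumℚ≡sum : ∀ {k} (f : Fin k → ℚ) → sumℚ G f ≡ ℚ∑.sum f
    sumℚ≡sum {zero}  f = refl
    sumℚ≡sum {suc k} f = cong (f zero ℚ.+_) (sumℚ≡sum (f ∘ suc))

-- Linear algebra over ℚ

module _ where

  open import Data.Nat using (_≤_)
  open import Data.Rational using (_+_; _*_; -_; _-_)
  open +-*-Solver using (solve; _:+_; _:*_; :-_; _:-_; _:=_; con)

  lincomb : ∀ {k m} → (Fin k → ℚ) → (Fin k → Fin m → ℚ) → Fin m → ℚ
  lincomb {k} c ws j = ∑[ i < k ] (c i * ws i j)

  IndependentOn : ∀ {k m} → (Fin m → Bool) → (Fin k → Fin m → ℚ) → Set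
  IndependentOn T ws = ∀ c → (∀ j → T j ≡ true → lincomb c ws j ≡ 0ℚ) → ∀ i → c i ≡ 0ℚ

  p≢0⇒p*q≡0⇒q≡0 : ∀ {p q} → p ≢ 0ℚ → p * q ≡ 0ℚ → q ≡ 0ℚ
  p≢0⇒p*q≡0⇒q≡0 {p} {q} p≢0 pq≡0 = begin
    q                ≡⟨ ℚP.*-identityˡ q ⟨
    1ℚ * q           ≡⟨ cong (_* q) (ℚP.*-inverseˡ p) ⟨
    ℚ.1/ p * p * q   ≡⟨ ℚP.*-assoc (ℚ.1/ p) p q ⟩
    ℚ.1/ p * (p * q) ≡⟨ cong (ℚ.1/ p *_) pq≡0 ⟩
    ℚ.1/ p * 0ℚ      ≡⟨ ℚP.*-zeroʳ (ℚ.1/ p) ⟩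
    0ℚ               ∎
    where
      open ≡-Reasoning
      instance _ = ℚ.≢-nonZero p≢0

  independentOn-tail : ∀ {k m} {T : Fin (suc m) → Bool} {ws : Fin k → Fin (suc m) → ℚ} →
                       (T zero ≡ true → ∀ i → ws i zero ≡ 0ℚ) →
                       IndependentOn T ws → IndependentOn (T ∘ suc) (λ i → ws i ∘ suc)
  independentOn-tail {k} {ws = ws} vanish ind c combo = ind c λ where
    zero    T₀ → trans (ℚ∑.sum-cong-≗ λ i → trans (cong (c i *_) (vanish T₀ i)) (ℚP.*-zeroʳ (c i)))
                       (ℚ∑.sum-replicate-zero k)
    (suc j) Tj → combo j Tj

  sum-single : ∀ {k} (a : Fin k) (f : Fin k → ℚ) → (∀ j → j ≢ a → f j ≡ 0ℚ) → ℚ∑.sum f ≡ f a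
  sum-single {suc k} a f off = begin
    ℚ∑.sum f                          ≡⟨ ℚ∑.sum-remove {i = a} f ⟩
    f a + ∑[ j < k ] f (punchIn a j)  ≡⟨ cong (f a +_) (ℚ∑.sum-cong-≗ λ j → off (punchIn a j) (FinP.punchInᵢ≢i a j)) ⟩
    f a + ∑[ j < k ] 0ℚ               ≡⟨ cong (f a +_) (ℚ∑.sum-replicate-zero k) ⟩
    f a + 0ℚ                          ≡⟨ ℚP.+-identityʳ (f a) ⟩
    f a                               ∎
    where open ≡-Reasoning

  -- Gaussian elimination of coordinate 0, using ws a as pivot.
  module Elimination {k m} (ws : Fin (suc k) → Fin (suc m) → ℚ) (a : Fin (suc k)) where

    α : ℚ
    α = ws a zero

    β : Fin k → ℚ
    β i = ws (punchIn a i) zero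

    reduced : Fin k → Fin m → ℚ
    reduced i j = α * ws (punchIn a i) (suc j) - β i * ws a (suc j)

    lift : (Fin k → ℚ) → Fin (suc k) → ℚ
    lift c i with i FinP.≟ a
    ... | yes _   = ∑[ i′ < k ] (c i′ * - β i′)
    ... | no  i≢a = α * c (punchOut (i≢a ∘ sym))

    lift-pivot : ∀ c → lift c a ≡ ∑[ i < k ] (c i * - β i)
    lift-pivot c with a FinP.≟ a
    ... | yes _ = refl
    ... | no a≢a = contradiction refl a≢a

    lift-punchIn : ∀ c i → lift c (punchIn a i) ≡ α * c i
    lift-punchIn c i with punchIn a i FinP.≟ a
    ... | yes eq = contradiction eq (FinP.punchInᵢ≢i a i)
    ... | no  _  = cong (λ i′ → α * c i′) (FinP.punchOut-punchIn a)

    lincomb-lift : ∀ c j → lincomb (lift c) ws j ≡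
                   ∑[ i < k ] (c i * (α * ws (punchIn a i) j - β i * ws a j))
    lincomb-lift c j = begin
      lincomb (lift c) ws j
        ≡⟨ ℚ∑.sum-remove {i = a} (λ i → lift c i * ws i j) ⟩
      lift c a * ws a j + ∑[ i < k ] (lift c (punchIn a i) * ws (punchIn a i) j)
        ≡⟨ cong₂ (λ x y → x * ws a j + y) (lift-pivot c)
                 (ℚ∑.sum-cong-≗ λ i → cong (_* ws (punchIn a i) j) (lift-punchIn c i)) ⟩
      ∑[ i < k ] (c i * - β i) * ws a j + ∑[ i < k ] (α * c i * ws (punchIn a i) j)
        ≡⟨ cong (_+ ∑[ i < k ] (α * c i * ws (punchIn a i) j))
                (ℚ∑.*-distribʳ-sum (ws a j) (λ i → c i * - β i)) ⟩
      ∑[ i < k ] (c i * - β i * ws a j) + ∑[ i < k ] (α * c i * ws (punchIn a i) j)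
        ≡⟨ ℚ∑.∑-distrib-+ (λ i → c i * - β i * ws a j) (λ i → α * c i * ws (punchIn a i) j) ⟨
      ∑[ i < k ] (c i * - β i * ws a j + α * c i * ws (punchIn a i) j)
        ≡⟨ ℚ∑.sum-cong-≗ (λ i → solve 5 (λ c β w α v → c :* (:- β) :* w :+ α :* c :* v
                                                   := c :* (α :* v :- β :* w))
                                         refl (c i) (β i) (ws a j) α (ws (punchIn a i) j)) ⟩
      ∑[ i < k ] (c i * (α * ws (punchIn a i) j - β i * ws a j)) ∎
      where open ≡-Reasoning

    reduced-independent : α ≢ 0ℚ → ∀ {T} → IndependentOn T ws → IndependentOn (T ∘ suc) reduced
    reduced-independent α≢0 {T} ind c combo i =
      p≢0⇒p*q≡0⇒q≡0 α≢0 (trans (sym (lift-punchIn c i)) (ind (lift c) lifted-combo (punchIn a i)))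
      where
        lifted-combo : ∀ j → T j ≡ true → lincomb (lift c) ws j ≡ 0ℚ
        lifted-combo zero    _  = trans (lincomb-lift c zero) (trans
          (ℚ∑.sum-cong-≗ λ i → trans (cong (c i *_) (solve 2 (λ α β → α :* β :- β :* α := con 0ℚ) refl α (β i)))
                                    (ℚP.*-zeroʳ (c i)))
          (ℚ∑.sum-replicate-zero k))
        lifted-combo (suc j) Tj = trans (lincomb-lift c (suc j)) (combo j Tj)

  independentOn⇒≤count : ∀ {k m} (T : Fin m → Bool) (ws : Fin k → Fin m → ℚ) →
                         IndependentOn T ws → k ≤ count T
  independentOn⇒≤count {zero}          T ws ind = z≤n
  independentOn⇒≤count {suc k} {zero}  T ws ind = contradiction (ind (λ _ → 1ℚ) (λ ()) zero) λ ()
  independentOn⇒≤count {suc k} {suc m} T ws ind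
    with T zero in T₀ | FinP.any? (λ i → ¬? (ws i zero ℚP.≟ 0ℚ))
  ... | false | _ = independentOn⇒≤count (T ∘ suc) (λ i → ws i ∘ suc)
                      (independentOn-tail {ws = ws} (λ T₀′ → contradiction (trans (sym T₀) T₀′) λ ()) ind)
  ... | true  | no ∄pivot = ℕP.m≤n⇒m≤1+n (independentOn⇒≤count (T ∘ suc) (λ i → ws i ∘ suc)
                      (independentOn-tail {ws = ws}
                        (λ _ i → decidable-stable (ws i zero ℚP.≟ 0ℚ) (λ ws≢0 → ∄pivot (i , ws≢0))) ind))
  ... | true  | yes (a , α≢0) = s≤s (independentOn⇒≤count (T ∘ suc) (Elimination.reduced ws a)
                      (Elimination.reduced-independent ws a α≢0 ind))

-- The kernel of the adjacency matrix

module _ {n} (G : SignedGraph n) where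

  open import Data.Nat using (_≤_)
  open import Data.Rational using (_+_; _*_)
  open +-*-Solver using (solve; _:*_; _:=_)

  KernelDetermining : (Fin n → Bool) → Set
  KernelDetermining T = ∀ x → InKernel G x → (∀ i → T i ≡ true → x i ≡ 0ℚ) → ∀ i → x i ≡ 0ℚ

  lincomb-inKernel : ∀ {k} (c : Fin k → ℚ) (vs : Fin k → Fin n → ℚ) →
                     (∀ i → InKernel G (vs i)) → InKernel G (lincomb c vs)
  lincomb-inKernel {k} c vs ker r = begin
    sumℚ G (λ j → A G r j * lincomb c vs j)
      ≡⟨ sumℚ≡sum G (λ j → A G r j * lincomb c vs j) ⟩
    ∑[ j < n ] (A G r j * ∑[ i < k ] (c i * vs i j))
      ≡⟨ ℚ∑.sum-cong-≗ (λ j → ℚ∑.*-distribˡ-sum (A G r j) (λ i → c i * vs i j)) ⟩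
    ∑[ j < n ] ∑[ i < k ] (A G r j * (c i * vs i j))
      ≡⟨ ℚ∑.∑-comm (λ j i → A G r j * (c i * vs i j)) ⟩
    ∑[ i < k ] ∑[ j < n ] (A G r j * (c i * vs i j))
      ≡⟨ ℚ∑.sum-cong-≗ (λ i → ℚ∑.sum-cong-≗ λ j →
           solve 3 (λ a c v → a :* (c :* v) := c :* (a :* v)) refl (A G r j) (c i) (vs i j)) ⟩
    ∑[ i < k ] ∑[ j < n ] (c i * (A G r j * vs i j))
      ≡⟨ ℚ∑.sum-cong-≗ (λ i → ℚ∑.*-distribˡ-sum (c i) (λ j → A G r j * vs i j)) ⟨
    ∑[ i < k ] (c i * ∑[ j < n ] (A G r j * vs i j))
      ≡⟨ ℚ∑.sum-cong-≗ (λ i → trans (cong (c i *_) (trans (sym (sumℚ≡sum G (λ j → A G r j * vs i j))) (ker i r)))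
                                    (ℚP.*-zeroʳ (c i))) ⟩
    ∑[ i < k ] 0ℚ
      ≡⟨ ℚ∑.sum-replicate-zero k ⟩
    0ℚ ∎
    where open ≡-Reasoning

  nullity≤count : ∀ {η} (T : Fin n → Bool) → IsNullity G η → KernelDetermining T → η ≤ count T
  nullity≤count T ((vs , ker , indep) , _) determining =
    independentOn⇒≤count T vs λ c combo →
      indep c λ j → trans (sumℚ≡sum G (λ i → c i * vs i j))
                          (determining (lincomb c vs) (lincomb-inKernel c vs ker) combo j)

  A-nonzero : ∀ {r j} → Edge G r j → A G r j ≢ 0ℚ
  A-nonzero {r} {j} rj rewrite rj with sgn G r j
  ... | Sign.+ = λ ()
  ... | Sign.- = λ ()

  inKernel-lastNeighbour : ∀ {x} → InKernel G x → ∀ {r w} → Edge G r w →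
                           (∀ j → j ≢ w → Edge G r j → x j ≡ 0ℚ) → x w ≡ 0ℚ
  inKernel-lastNeighbour {x} ker {r} {w} rw others = p≢0⇒p*q≡0⇒q≡0 (A-nonzero rw) (begin
    A G r w * x w                      ≡⟨ sum-single w (λ j → A G r j * x j) off ⟨
    ∑[ j < n ] (A G r j * x j)         ≡⟨ sumℚ≡sum G (λ j → A G r j * x j) ⟨
    sumℚ G (λ j → A G r j * x j)       ≡⟨ ker r ⟩
    0ℚ                                 ∎)
    where
      open ≡-Reasoning
      off : ∀ j → j ≢ w → A G r j * x j ≡ 0ℚ
      off j j≢w with adj G r j in rj
      ... | true  = trans (cong (signℚ G (sgn G r j) *_) (others j j≢w rj)) (ℚP.*-zeroʳ (signℚ G (sgn G r j)))
      ... | false = ℚP.*-zeroˡ (x j)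

-- Degrees

module _ {n} (G : SignedGraph n) where

  open import Data.Nat using (_+_; _<_)

  edge-sym : ∀ {a b} → Edge G a b → Edge G b a
  edge-sym {a} {b} ab = trans (adj-sym G b a) ab

  pendant-neighbour : ∀ {u v} → Pendant G u → Edge G u v → ∀ {j} → Edge G u j → j ≡ v
  pendant-neighbour {u} {v} deg≡1 uv {j} uj with j FinP.≟ v
  ... | yes j≡v = j≡v
  ... | no  j≢v = contradiction 1<deg (ℕP.<-irrefl (sym deg≡1))
    where
      1<deg : 1 < degree G u
      1<deg = subst₂ _<_ (count-≟ v) (sym (countF≡count G (adj G u)))
                (count-< j (λ i i≡v → subst (Edge G u) (sym (does-true⇒ (i FinP.≟ v) i≡v)) uv)
                           (dec-false (j FinP.≟ v) j≢v) uj)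

  degree-sum : ℕ∑.sum (λ i → count (adj G i)) ≡ edgeCount G + edgeCount G
  degree-sum = begin
    ℕ∑.sum (λ i → count (adj G i))
      ≡⟨ ℕ∑.sum-cong-≗ (λ i → count-split (adj G i) (before i)) ⟩
    ℕ∑.sum (λ i → count (λ j → adj G i j ∧ before i j) + count (λ j → adj G i j ∧ not (before i j)))
      ≡⟨ ℕ∑.∑-distrib-+ (λ i → count (λ j → adj G i j ∧ before i j)) _ ⟩
    E + ℕ∑.sum (λ i → count (λ j → adj G i j ∧ not (before i j)))
      ≡⟨ cong (E +_) (ℕ∑.sum-cong-≗ λ i → count-cong (flip i)) ⟩
    E + ℕ∑.sum (λ i → count (λ j → adj G j i ∧ before j i))
      ≡⟨ cong (E +_) (ℕ∑.∑-comm (λ i j → indicator (adj G j i ∧ before j i))) ⟩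
    E + E
      ≡⟨ cong₂ _+_ edgeCount≡E edgeCount≡E ⟨
    edgeCount G + edgeCount G ∎
    where
      open ≡-Reasoning
      before : Fin n → Fin n → Bool
      before i j = toℕ i ℕ.<ᵇ toℕ j
      <ᵇ⇒< : ∀ {i j} → before i j ≡ true → toℕ i < toℕ j
      <ᵇ⇒< {i} {j} i<j = ℕP.<ᵇ⇒< (toℕ i) (toℕ j) (subst T (sym i<j) _)
      ≮ : ∀ {i j} → before i j ≡ false → ¬ toℕ i < toℕ j
      ≮ i≮j i<j = subst T i≮j (ℕP.<⇒<ᵇ i<j)
      E : ℕ
      E = ℕ∑.sum (λ i → count (λ j → adj G i j ∧ before i j))
      edgeCount≡E : edgeCount G ≡ E
      edgeCount≡E = trans (sumℕ≡sum G (λ i → countF G (λ j → adj G i j ∧ before i j)))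
                          (ℕ∑.sum-cong-≗ λ i → countF≡count G (λ j → adj G i j ∧ before i j))
      flip : ∀ i j → adj G i j ∧ not (before i j) ≡ adj G j i ∧ before j i
      flip i j with before i j in i<j | before j i in j<i
      ... | true  | true  = contradiction (<ᵇ⇒< {i} {j} i<j) (ℕP.<⇒≯ (<ᵇ⇒< {j} {i} j<i))
      ... | true  | false = cong (_∧ false) (adj-sym G i j)
      ... | false | true  = cong (_∧ true) (adj-sym G i j)
      ... | false | false
        with FinP.toℕ-injective (ℕP.≤-antisym (ℕP.≮⇒≥ (≮ {j} {i} j<i)) (ℕP.≮⇒≥ (≮ {i} {j} i<j)))
      ...   | refl = trans (cong (_∧ true) (irrefl G i)) (cong (_∧ false) (sym (irrefl G i)))

-- Matchings

MatchEdge : ∀ {n} → List (Fin n × Fin n) → Fin n → Fin n → Set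
MatchEdge M i j = (i , j) ∈ M ⊎ (j , i) ∈ M

matchEdge? : ∀ {n} (M : List (Fin n × Fin n)) i j → Dec (MatchEdge M i j)
matchEdge? M i j = Any.any? (≡-dec FinP._≟_ FinP._≟_ (i , j)) M
             ⊎-dec Any.any? (≡-dec FinP._≟_ FinP._≟_ (j , i)) M

matchEdge-sym : ∀ {n} {M : List (Fin n × Fin n)} {i j} → MatchEdge M i j → MatchEdge M j i
matchEdge-sym (inj₁ ij) = inj₂ ij
matchEdge-sym (inj₂ ji) = inj₁ ji

module _ {n} (G : SignedGraph n) where

  open import Data.Nat using (_+_)

  matchEdge⇒Edge : ∀ {M} → IsMatching G M → ∀ {i j} → MatchEdge M i j → Edge G i j
  matchEdge⇒Edge (edges , _) (inj₁ ij) = All.lookup edges ij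
  matchEdge⇒Edge (edges , _) (inj₂ ji) = edge-sym G (All.lookup edges ji)

  matchEdge⇒matched : ∀ M {i j} → MatchEdge M i j → j ∈ matchedVertices G M
  matchEdge⇒matched (_ ∷ M) (inj₁ (Any.here refl))  = Any.there (Any.here refl)
  matchEdge⇒matched (_ ∷ M) (inj₂ (Any.here refl))  = Any.here refl
  matchEdge⇒matched (_ ∷ M) (inj₁ (Any.there ij))   = Any.there (Any.there (matchEdge⇒matched M (inj₁ ij)))
  matchEdge⇒matched (_ ∷ M) (inj₂ (Any.there ji))   = Any.there (Any.there (matchEdge⇒matched M (inj₂ ji)))

  matched⇒matchEdge : ∀ M {i} → i ∈ matchedVertices G M → ∃ (MatchEdge M i)
  matched⇒matchEdge ((_ , z) ∷ M) (Any.here refl)            = z , inj₁ (Any.here refl)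
  matched⇒matchEdge ((x , _) ∷ M) (Any.there (Any.here refl)) = x , inj₂ (Any.here refl)
  matched⇒matchEdge (_ ∷ M) (Any.there (Any.there i∈))
    with matched⇒matchEdge M i∈
  ... | j , inj₁ ij = j , inj₁ (Any.there ij)
  ... | j , inj₂ ji = j , inj₂ (Any.there ji)

  length-matchedVertices : ∀ M → length (matchedVertices G M) ≡ length M + length M
  length-matchedVertices []      = refl
  length-matchedVertices (_ ∷ M) =
    cong suc (trans (cong suc (length-matchedVertices M)) (sym (ℕP.+-suc (length M) (length M))))

  matchEdge-unique : ∀ M → Unique (matchedVertices G M) →
                     ∀ {a b q} → MatchEdge M a q → MatchEdge M b q → a ≡ b
  matchEdge-unique [] _ (inj₁ ()) _
  matchEdge-unique [] _ (inj₂ ()) _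
  matchEdge-unique ((x , z) ∷ M) (x∉ ∷ z∉ ∷ !M) e₁ e₂ = unique (uncons e₁) (uncons e₂)
    where
      HeadEdge : Fin n → Fin n → Set
      HeadEdge a q = (a ≡ x × q ≡ z) ⊎ (a ≡ z × q ≡ x)

      uncons : ∀ {a q} → MatchEdge ((x , z) ∷ M) a q → HeadEdge a q ⊎ MatchEdge M a q
      uncons (inj₁ (Any.here refl)) = inj₁ (inj₁ (refl , refl))
      uncons (inj₂ (Any.here refl)) = inj₁ (inj₂ (refl , refl))
      uncons (inj₁ (Any.there aq))  = inj₂ (inj₁ aq)
      uncons (inj₂ (Any.there qa))  = inj₂ (inj₂ qa)

      x≢z : x ≢ z
      x≢z = All.head x∉

      fresh : ∀ {a q} → HeadEdge a q → q ∉ matchedVertices G M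
      fresh (inj₁ (_ , refl)) = All¬⇒¬Any z∉
      fresh (inj₂ (_ , refl)) = All¬⇒¬Any (All.tail x∉)

      unique : ∀ {a b q} → HeadEdge a q ⊎ MatchEdge M a q → HeadEdge b q ⊎ MatchEdge M b q → a ≡ b
      unique (inj₂ aq) (inj₂ bq) = matchEdge-unique M !M aq bq
      unique (inj₁ aq) (inj₂ bq) = contradiction (matchEdge⇒matched M bq) (fresh aq)
      unique (inj₂ aq) (inj₁ bq) = contradiction (matchEdge⇒matched M aq) (fresh bq)
      unique (inj₁ (inj₁ (refl , _)))    (inj₁ (inj₁ (refl , _)))    = refl
      unique (inj₁ (inj₂ (refl , _)))    (inj₁ (inj₂ (refl , _)))    = refl
      unique (inj₁ (inj₁ (_ , refl)))    (inj₁ (inj₂ (_ , q≡x)))     = contradiction (sym q≡x) x≢z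
      unique (inj₁ (inj₂ (_ , refl)))    (inj₁ (inj₁ (_ , q≡z)))     = contradiction q≡z x≢z

-- Spanning forests by breadth-first search

least : (ℕ → Bool) → ℕ → ℕ
least f zero    = 0
least f (suc k) = if f 0 then 0 else suc (least (f ∘ suc) k)

least-holds : ∀ (f : ℕ → Bool) k → f k ≡ true → f (least f k) ≡ true
least-holds f zero    fk = fk
least-holds f (suc k) fk with f 0 in f0
... | true  = f0
... | false = least-holds (f ∘ suc) k fk

least-minimal : ∀ (f : ℕ → Bool) k {k′} → f k′ ≡ true → least f k ℕ.≤ k′
least-minimal f zero    _ = z≤n
least-minimal f (suc k) {k′} fk′ with f 0 in f0 | k′
... | true  | _       = z≤n
... | false | zero    = contradiction (trans (sym fk′) f0) λ ()
... | false | suc k′′ = s≤s (least-minimal (f ∘ suc) k fk′)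

record RootedForest {n} (E : Fin n → Fin n → Bool) (roots : List (Fin n)) : Set where
  field
    parent       : Fin n → Maybe (Fin n)
    depth        : Fin n → ℕ
    parent-edge  : ∀ {i j} → parent i ≡ just j → E i j ≡ true
    parent-depth : ∀ {i j} → parent i ≡ just j → depth j ℕ.< depth i
    orphan-root  : ∀ {i} → parent i ≡ nothing → i ∈ roots

module BreadthFirst {n} (E : Fin n → Fin n → Bool) (roots : List (Fin n)) where

  open import Data.Nat using (_≤_; _<_)

  _⟶_ : Fin n → Fin n → Set
  i ⟶ j = E i j ≡ true

  mutual
    reach : ℕ → Fin n → Bool
    reach zero    i = does (i ∈? roots)
    reach (suc k) i = reach k i ∨ does (advance? k i)

    advance? : ∀ k i → Dec (∃ λ j → E i j ∧ reach k j ≡ true)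
    advance? k i = FinP.any? λ j → E i j ∧ reach k j Data.Bool.≟ true

  reach-star : ∀ {i r} → Star _⟶_ i r → r ∈ roots → ∃ λ k → reach k i ≡ true
  reach-star {i} ε r∈ = 0 , dec-true (i ∈? roots) r∈
  reach-star {i} (_◅_ {j = j} i⟶j path) r∈ with reach-star path r∈
  ... | k , j-reached = suc k , trans (cong (reach k i ∨_) advances) (∨-zeroʳ (reach k i))
    where
      advances : does (advance? k i) ≡ true
      advances = dec-true (advance? k i) (j , cong₂ _∧_ i⟶j j-reached)

  parentAt : Fin n → ℕ → Maybe (Fin n)
  parentAt i zero    = nothing
  parentAt i (suc k) = Maybe.map proj₁ (dec⇒maybe (advance? k i))

  parentAt-just : ∀ {i j} k → parentAt i k ≡ just j → ∃ λ k′ → k ≡ suc k′ × E i j ∧ reach k′ j ≡ true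
  parentAt-just {i} (suc k) eq with advance? k i
  parentAt-just {i} (suc k) refl | yes (j , ok) = k , refl , ok

  parentless-root : ∀ i k → reach k i ≡ true → (∀ {k′} → reach k′ i ≡ true → k ≤ k′) →
                    parentAt i k ≡ nothing → i ∈ roots
  parentless-root i zero    reached minimal _ = does-true⇒ (i ∈? roots) reached
  parentless-root i (suc k) reached minimal eq with reach k i in earlier | advance? k i
  ... | true  | _     = contradiction (minimal earlier) ℕP.1+n≰n
  ... | false | no _  = contradiction reached λ ()
  ... | false | yes _ = contradiction eq λ ()

  spanningForest : (∀ i → ∃ λ r → r ∈ roots × Star _⟶_ i r) → RootedForest E roots
  spanningForest connected = record
    { parent       = parent
    ; depth        = depth
    ; parent-edge  = λ {i} eq → ∧-conicalˡ _ _ (proj₂ (proj₂ (parentAt-just (depth i) eq)))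
    ; parent-depth = parent-depth
    ; orphan-root  = λ {i} → parentless-root i (depth i) (depth-reached i)
                               (least-minimal (λ k → reach k i) (proj₁ (reachable i)))
    }
    where
      reachable : ∀ i → ∃ λ k → reach k i ≡ true
      reachable i = let r , r∈ , path = connected i in reach-star path r∈

      depth : Fin n → ℕ
      depth i = least (λ k → reach k i) (proj₁ (reachable i))

      depth-reached : ∀ i → reach (depth i) i ≡ true
      depth-reached i = least-holds (λ k → reach k i) (proj₁ (reachable i)) (proj₂ (reachable i))

      parent : Fin n → Maybe (Fin n)
      parent i = parentAt i (depth i)

      parent-depth : ∀ {i j} → parent i ≡ just j → depth j ℕ.< depth i
      parent-depth {i} {j} eq with parentAt-just (depth i) eq
      ... | k , depth≡ , ok = subst (depth j <_) (sym depth≡)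
              (s≤s (least-minimal (λ k → reach k j) (proj₁ (reachable j)) (∧-conicalʳ _ _ ok)))

-- Deleting an edge of a cycle

module _ {n} (G : SignedGraph n) where

  open import Data.Nat using (_≤_)

  EdgeOf : Fin n × Fin n → Set
  EdgeOf (a , b) = Edge G a b

  pairs-++ : ∀ xs z ys → pairs G (xs ++ z ∷ ys) ≡ pairs G (xs ++ [ z ]) ++ pairs G (z ∷ ys)
  pairs-++ []            z ys = refl
  pairs-++ (x ∷ [])      z ys = refl
  pairs-++ (x ∷ x′ ∷ xs) z ys = cong ((x , x′) ∷_) (pairs-++ (x′ ∷ xs) z ys)

  cycEdges-rotate : ∀ {P : Fin n × Fin n → Set} as v bs →
                    All P (cycEdges G (as ++ v ∷ bs)) → All P (pairs G (v ∷ (bs ++ as) ++ [ v ]))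
  cycEdges-rotate {P} []       v bs ps rewrite ++-identityʳ bs = ps
  cycEdges-rotate {P} (a ∷ as) v bs ps = subst (All P) (sym rotated) (AllP.++⁺ (proj₂ split) (proj₁ split))
    where
      split : All P (pairs G (a ∷ as ++ [ v ])) × All P (pairs G (v ∷ bs ++ [ a ]))
      split = AllP.++⁻ (pairs G (a ∷ as ++ [ v ]))
                (subst (All P) (trans (cong (λ xs → pairs G (a ∷ xs)) (++-assoc as (v ∷ bs) [ a ]))
                                      (pairs-++ (a ∷ as) v (bs ++ [ a ]))) ps)
      rotated : pairs G (v ∷ (bs ++ a ∷ as) ++ [ v ]) ≡ pairs G (v ∷ bs ++ [ a ]) ++ pairs G (a ∷ as ++ [ v ])
      rotated = trans (cong (λ xs → pairs G (v ∷ xs)) (++-assoc bs (a ∷ as) [ v ]))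
                      (pairs-++ (v ∷ bs) a (as ++ [ v ]))

  module WithoutEdge (v y : Fin n) where

    SameEdge : Fin n → Fin n → Set
    SameEdge a b = (a ≡ v × b ≡ y) ⊎ (a ≡ y × b ≡ v)

    sameEdge? : ∀ a b → Dec (SameEdge a b)
    sameEdge? a b = (a FinP.≟ v ×-dec b FinP.≟ y) ⊎-dec (a FinP.≟ y ×-dec b FinP.≟ v)

    sameEdge-sym : ∀ {a b} → SameEdge a b → SameEdge b a
    sameEdge-sym (inj₁ (a≡v , b≡y)) = inj₂ (b≡y , a≡v)
    sameEdge-sym (inj₂ (a≡y , b≡v)) = inj₁ (b≡v , a≡y)

    adj⁻ : Fin n → Fin n → Bool
    adj⁻ a b = adj G a b ∧ not (does (sameEdge? a b))

    _⟶⁻_ : Fin n → Fin n → Set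
    a ⟶⁻ b = adj⁻ a b ≡ true

    ⟶⁻-intro : ∀ {a b} → Edge G a b → ¬ SameEdge a b → a ⟶⁻ b
    ⟶⁻-intro {a} {b} ab ¬same = cong₂ _∧_ ab (cong not (dec-false (sameEdge? a b) ¬same))

    ⟶⁻-edge : ∀ {a b} → a ⟶⁻ b → Edge G a b
    ⟶⁻-edge = ∧-conicalˡ _ _

    ⟶⁻-avoids : ∀ {a b} → a ⟶⁻ b → ¬ SameEdge a b
    ⟶⁻-avoids {a} {b} ab same =
      contradiction (trans (sym (∧-conicalʳ _ _ ab)) (cong not (dec-true (sameEdge? a b) same))) λ ()

    ⟶⁻-sym : ∀ {a b} → a ⟶⁻ b → b ⟶⁻ a
    ⟶⁻-sym ab = ⟶⁻-intro (edge-sym G (⟶⁻-edge ab)) (⟶⁻-avoids ab ∘ sameEdge-sym)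

    walk⁻ : Star _⟶⁻_ y v → ∀ {a b} → Walk G a b → Star _⟶⁻_ a b
    walk⁻ detour (here a)                = ε
    walk⁻ detour (step {a} {b} ab walk) = first ◅◅ walk⁻ detour walk
      where
        first : Star _⟶⁻_ a b
        first with sameEdge? a b
        ... | yes (inj₁ (refl , refl)) = Star.reverse ⟶⁻-sym detour
        ... | yes (inj₂ (refl , refl)) = detour
        ... | no  ¬same                = ⟶⁻-intro ab ¬same ◅ ε

    path⁻ : ∀ a rs → All EdgeOf (pairs G (a ∷ rs ++ [ v ])) → All (v ≢_) (a ∷ rs) → All (y ≢_) rs →
            (a ≡ y → rs ≢ []) → Star _⟶⁻_ a v
    path⁻ a []       (av ∷ [])  (v≢a ∷ [])    []          a≡y⇒nonempty = ⟶⁻-intro av not-vy ◅ ε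
      where
        not-vy : ¬ SameEdge a v
        not-vy (inj₁ (a≡v , _)) = v≢a (sym a≡v)
        not-vy (inj₂ (a≡y , _)) = a≡y⇒nonempty a≡y refl
    path⁻ a (b ∷ rs) (ab ∷ bs)  (v≢a ∷ v∉b∷rs) (y≢b ∷ y∉rs) _ =
      ⟶⁻-intro ab not-vy ◅ path⁻ b rs bs v∉b∷rs y∉rs (λ b≡y → contradiction (sym b≡y) y≢b)
      where
        not-vy : ¬ SameEdge a b
        not-vy (inj₁ (a≡v , _)) = v≢a (sym a≡v)
        not-vy (inj₂ (_ , b≡v)) = All.head v∉b∷rs (sym b≡v)

  cycle-detour : ∀ {v} → OnCycle G v → ∃ λ y → Edge G v y × Star (WithoutEdge._⟶⁻_ v y) y v
  cycle-detour {v} (cs , (!cs , 3≤ , edges) , v∈) with ∈-∃++ v∈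
  ... | as , bs , refl = detour (bs ++ as) (PermS.Unique-resp-↭ (setoid (Fin n)) (↭⇒↭ₛ rotation) !cs)
                           (subst (3 ≤_) (↭-length rotation) 3≤) (cycEdges-rotate as v bs edges)
    where
      rotation : as ++ [ v ] ++ bs ↭ v ∷ bs ++ as
      rotation = ↭-trans (shift v as bs) (prep v (PermP.++-comm as bs))
      detour : ∀ rs → Unique (v ∷ rs) → 3 ≤ length (v ∷ rs) → All EdgeOf (pairs G (v ∷ rs ++ [ v ])) →
               ∃ λ y → Edge G v y × Star (WithoutEdge._⟶⁻_ v y) y v
      detour []                 _              (s≤s ()) _
      detour (_ ∷ [])           _              (s≤s (s≤s ())) _
      detour (y ∷ rest@(_ ∷ _)) (v∉ ∷ y∉ ∷ _) _ (vy ∷ es) =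
        y , vy , WithoutEdge.path⁻ v y y rest es v∉ y∉ λ _ ()

-- The determining set

module DeterminingSet {n} (G : SignedGraph n) {u v y : Fin n}
  (u-pendant : ∀ {j} → Edge G u j → j ≡ v) (uv : Edge G u v) (vy : Edge G v y)
  {roots : List (Fin n)} (F : RootedForest (WithoutEdge.adj⁻ G v y) roots)
  {M : List (Fin n × Fin n)} (matching : IsMatching G M)
  where

  open import Data.Nat using (_+_; _∸_; _≤_; _<_)
  open RootedForest F
  open WithoutEdge G v y using (SameEdge; sameEdge-sym; ⟶⁻-edge; ⟶⁻-avoids)

  _≟ₘ_ : (p q : Maybe (Fin n)) → Dec (p ≡ q)
  _≟ₘ_ = MaybeP.≡-dec FinP._≟_

  Inner : Fin n → Set
  Inner i = i ≢ u × i ≢ v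

  inner? : ∀ i → Dec (Inner i)
  inner? i = ¬? (i FinP.≟ u) ×-dec ¬? (i FinP.≟ v)

  MatchedUp : Fin n → Set
  MatchedUp i = ∃ λ j → parent i ≡ just j × Inner i × Inner j × MatchEdge M i j

  matchedUp? : ∀ i → Dec (MatchedUp i)
  matchedUp? i = FinP.any? λ j → (parent i ≟ₘ just j) ×-dec inner? i ×-dec inner? j ×-dec matchEdge? M i j

  MatchedDown : Fin n → Set
  MatchedDown i = ∃ λ c → parent c ≡ just i × MatchedUp c

  matchedDown? : ∀ i → Dec (MatchedDown i)
  matchedDown? i = FinP.any? λ c → (parent c ≟ₘ just i) ×-dec matchedUp? c

  TreeEdge : Fin n → Fin n → Set
  TreeEdge i j = parent i ≡ just j ⊎ parent j ≡ just i

  treeEdge? : ∀ i j → Dec (TreeEdge i j)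
  treeEdge? i j = (parent i ≟ₘ just j) ⊎-dec (parent j ≟ₘ just i)

  CrossEdge : Fin n → Fin n → Set
  CrossEdge i j = Inner i × Inner j × Edge G i j × ¬ TreeEdge i j

  crossEdge? : ∀ i j → Dec (CrossEdge i j)
  crossEdge? i j = inner? i ×-dec inner? j ×-dec (adj G i j Data.Bool.≟ true) ×-dec ¬? (treeEdge? i j)

  crossDegree : Fin n → ℕ
  crossDegree i = count (λ j → does (crossEdge? i j))

  Determining : Fin n → Set
  Determining i = Inner i × ((¬ MatchedUp i × ¬ MatchedDown i) ⊎ 0 < crossDegree i)

  determining? : ∀ i → Dec (Determining i)
  determining? i = inner? i ×-dec ((¬? (matchedUp? i) ×-dec ¬? (matchedDown? i)) ⊎-dec (0 ℕ.<? crossDegree i))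

  parent-Edge : ∀ {i j} → parent i ≡ just j → Edge G i j
  parent-Edge = ⟶⁻-edge ∘ parent-edge

  parent-acyclic : ∀ {i j} → parent i ≡ just j → parent j ≡ just i → ⊥
  parent-acyclic i→j j→i = ℕP.<-asym (parent-depth i→j) (parent-depth j→i)

  ≢u-of-neighbour : ∀ {c j} → c ≢ v → Edge G c j → j ≢ u
  ≢u-of-neighbour c≢v cj refl = c≢v (u-pendant (edge-sym G cj))

  matchedUp-unique : ∀ {a b q} → MatchedUp a → MatchedUp b → parent a ≡ just q → parent b ≡ just q → a ≡ b
  matchedUp-unique (_ , a→ , _ , _ , aq) (_ , b→ , _ , _ , bq) a→q b→q
    rewrite just-injective (trans (sym a→) a→q) | just-injective (trans (sym b→) b→q) =
    matchEdge-unique G M (proj₂ matching) aq bq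

  matchedUp-parent : ∀ {j c} → MatchedUp j → parent j ≡ just c → ¬ MatchedUp c
  matchedUp-parent (_ , j→ , _ , _ , jc) j→c (c′ , c→c′ , _ , _ , cc′)
    rewrite just-injective (trans (sym j→) j→c)
    with matchEdge-unique G M (proj₂ matching) jc (matchEdge-sym cc′)
  ... | refl = parent-acyclic j→c c→c′

  nondetermining : ∀ {i} → Inner i → ¬ Determining i → MatchedUp i ⊎ MatchedDown i
  nondetermining {i} inner ¬det with matchedUp? i | matchedDown? i
  ... | yes up | _       = inj₁ up
  ... | no  _  | yes down = inj₂ down
  ... | no ¬up | no ¬down = contradiction (inner , inj₁ (¬up , ¬down)) ¬det

  crossEdge-determining : ∀ {i j} → CrossEdge i j → Determining i
  crossEdge-determining {i} {j} cross@(inner , _) =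
    inner , inj₂ (count-pos j (dec-true (crossEdge? i j) cross))

  inner-edge : ∀ {a b} → Inner a → Inner b → Edge G a b →
               parent a ≡ just b ⊎ parent b ≡ just a ⊎ (Determining a × Determining b)
  inner-edge {a} {b} inner-a inner-b ab with treeEdge? a b
  ... | yes (inj₁ a→b) = inj₁ a→b
  ... | yes (inj₂ b→a) = inj₂ (inj₁ b→a)
  ... | no ¬tree = inj₂ (inj₂ (crossEdge-determining (inner-a , inner-b , ab , ¬tree) ,
                               crossEdge-determining (inner-b , inner-a , edge-sym G ab , ¬tree ∘ Data.Sum.swap)))

  determiningᵇ : Fin n → Bool
  determiningᵇ i = does (determining? i)

  module Vanishing {x : Fin n → ℚ} (ker : InKernel G x) (x-T : ∀ i → determiningᵇ i ≡ true → x i ≡ 0ℚ)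
    where

    x-determining : ∀ {i} → Determining i → x i ≡ 0ℚ
    x-determining {i} det = x-T i (dec-true (determining? i) det)

    x-v : x v ≡ 0ℚ
    x-v = inKernel-lastNeighbour G ker uv λ j j≢v uj → contradiction (u-pendant uj) j≢v

    inner-neighbour : ∀ {c j} → Inner c → Edge G c j →
                      x j ≡ 0ℚ ⊎ j ≢ u × (parent c ≡ just j ⊎ parent j ≡ just c)
    inner-neighbour {c} {j} inner-c@(_ , c≢v) cj with j FinP.≟ v
    ... | yes refl = inj₁ x-v
    ... | no  j≢v with inner-edge inner-c (≢u-of-neighbour c≢v cj , j≢v) cj
    ...   | inj₁ c→j               = inj₂ (≢u-of-neighbour c≢v cj , inj₁ c→j)
    ...   | inj₂ (inj₁ j→c)        = inj₂ (≢u-of-neighbour c≢v cj , inj₂ j→c)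
    ...   | inj₂ (inj₂ (_ , det-j)) = inj₁ (x-determining det-j)

    height : Fin n → ℕ
    height i = ℕ∑.sum depth ∸ depth i

    -- By descending induction on depth: a vertex not matched upwards is forced to 0 by the row of a
    -- child matched to it, all of whose other children are deeper and not matched upwards.
    vanish-notMatchedUp : ∀ i → i ≢ u → ¬ MatchedUp i → x i ≡ 0ℚ
    vanish-notMatchedUp = WF.All.wfRec (On.wellFounded height <-wellFounded) _ _ descend
      where
        descend : ∀ i → (∀ {j} → height j < height i → j ≢ u → ¬ MatchedUp j → x j ≡ 0ℚ) →
               i ≢ u → ¬ MatchedUp i → x i ≡ 0ℚ
        descend i IH i≢u ¬up with determining? i
        ... | yes det = x-determining det
        ... | no ¬det = by-v (i FinP.≟ v)
          where
            by-v : Dec (i ≡ v) → x i ≡ 0ℚ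
            by-v (yes refl) = x-v
            by-v (no  i≢v) with nondetermining (i≢u , i≢v) ¬det
            ... | inj₁ up = contradiction up ¬up
            ... | inj₂ (c , c→i , up-c@(_ , _ , inner-c , _)) = inKernel-lastNeighbour G ker (parent-Edge c→i) others
              where
                others : ∀ j → j ≢ i → Edge G c j → x j ≡ 0ℚ
                others j j≢i cj with inner-neighbour inner-c cj
                ... | inj₁ xj≡0             = xj≡0
                ... | inj₂ (_   , inj₁ c→j) = contradiction (just-injective (trans (sym c→i) c→j)) (j≢i ∘ sym)
                ... | inj₂ (j≢u , inj₂ j→c) =
                  IH (ℕP.∸-monoʳ-< (ℕP.<-trans (parent-depth c→i) (parent-depth j→c)) (≤-sum depth j))
                     j≢u (λ up-j → matchedUp-parent up-j j→c up-c)

    -- By ascending induction on depth: a vertex matched upwards is forced to 0 by the row of its parent.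
    vanish : ∀ i → i ≢ u → x i ≡ 0ℚ
    vanish = WF.All.wfRec (On.wellFounded depth <-wellFounded) _ _ ascend
      where
        ascend : ∀ i → (∀ {j} → depth j < depth i → j ≢ u → x j ≡ 0ℚ) → i ≢ u → x i ≡ 0ℚ
        ascend i IH i≢u with matchedUp? i
        ... | no ¬up = vanish-notMatchedUp i i≢u ¬up
        ... | yes up@(q , i→q , _ , inner-q , _) =
          inKernel-lastNeighbour G ker (edge-sym G (parent-Edge i→q)) others
          where
            others : ∀ j → j ≢ i → Edge G q j → x j ≡ 0ℚ
            others j j≢i qj with inner-neighbour inner-q qj
            ... | inj₁ xj≡0             = xj≡0
            ... | inj₂ (j≢u , inj₁ q→j) = IH (ℕP.<-trans (parent-depth q→j) (parent-depth i→q)) j≢u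
            ... | inj₂ (j≢u , inj₂ j→q) with matchedUp? j
            ...   | yes up-j = contradiction (matchedUp-unique up-j up j→q i→q) j≢i
            ...   | no ¬up-j = vanish-notMatchedUp j j≢u ¬up-j

  kernelDetermining : KernelDetermining G determiningᵇ
  kernelDetermining x ker x-T i with i FinP.≟ u
  ... | no  i≢u  = Vanishing.vanish ker x-T i i≢u
  ... | yes refl = inKernel-lastNeighbour G ker (edge-sym G uv) λ j j≢u _ → Vanishing.vanish ker x-T j j≢u

  Unmatched : Fin n → Set
  Unmatched i = i ∉ matchedVertices G M

  unmatched? : ∀ i → Dec (Unmatched i)
  unmatched? i = ¬? (i ∈? matchedVertices G M)

  MatchedToV : Fin n → Set
  MatchedToV i = i ≢ u × MatchEdge M i v

  matchedToV? : ∀ i → Dec (MatchedToV i)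
  matchedToV? i = ¬? (i FinP.≟ u) ×-dec matchEdge? M i v

  determining-charged : ∀ {i} → Determining i → (Unmatched i × Inner i) ⊎ 0 < crossDegree i ⊎ MatchedToV i
  determining-charged (_ , inj₂ 0<cross) = inj₂ (inj₁ 0<cross)
  determining-charged {i} (inner@(i≢u , i≢v) , inj₁ (¬up , ¬down)) with i ∈? matchedVertices G M
  ... | no  unmatched = inj₁ (unmatched , inner)
  ... | yes matched with matched⇒matchEdge G M matched
  ...   | j , ij with j FinP.≟ v | j FinP.≟ u
  ...     | yes refl | _        = inj₂ (inj₂ (i≢u , ij))
  ...     | no  _    | yes refl = contradiction (u-pendant (matchEdge⇒Edge G matching (matchEdge-sym ij))) i≢v
  ...     | no  j≢v  | no  j≢u with treeEdge? i j
  ...       | yes (inj₁ i→j) = contradiction (j , i→j , inner , (j≢u , j≢v) , ij) ¬up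
  ...       | yes (inj₂ j→i) =
    contradiction (j , j→i , (i , j→i , (j≢u , j≢v) , inner , matchEdge-sym ij)) ¬down
  ...       | no  ¬tree      = inj₂ (inj₁ (count-pos j (dec-true (crossEdge? i j)
                                 (inner , (j≢u , j≢v) , matchEdge⇒Edge G matching ij , ¬tree))))

  unmatchedInnerᵇ matchedToVᵇ : Fin n → Bool
  unmatchedInnerᵇ i = does (unmatched? i ×-dec inner? i)
  matchedToVᵇ     i = does (matchedToV? i)

  count-determining : count determiningᵇ ≤ count unmatchedInnerᵇ + ℕ∑.sum crossDegree + count matchedToVᵇ
  count-determining = begin
    count determiningᵇ
      ≤⟨ count-≤-sum determiningᵇ charge
           (λ i det → charged (determining-charged (does-true⇒ (determining? i) det))) ⟩
    ℕ∑.sum charge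
      ≡⟨ ℕ∑.∑-distrib-+ (λ i → indicator (unmatchedInnerᵇ i) + crossDegree i) (indicator ∘ matchedToVᵇ) ⟩
    ℕ∑.sum (λ i → indicator (unmatchedInnerᵇ i) + crossDegree i) + count matchedToVᵇ
      ≡⟨ cong (_+ count matchedToVᵇ) (ℕ∑.∑-distrib-+ (indicator ∘ unmatchedInnerᵇ) crossDegree) ⟩
    count unmatchedInnerᵇ + ℕ∑.sum crossDegree + count matchedToVᵇ ∎
    where
      open ℕP.≤-Reasoning
      charge : Fin n → ℕ
      charge i = indicator (unmatchedInnerᵇ i) + crossDegree i + indicator (matchedToVᵇ i)
      charged : ∀ {i} → (Unmatched i × Inner i) ⊎ 0 < crossDegree i ⊎ MatchedToV i → 0 < charge i
      charged {i} (inj₁ unmatchedInner) =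
        ℕP.<-≤-trans (indicator-pos (dec-true (unmatched? i ×-dec inner? i) unmatchedInner))
                     (ℕP.≤-trans (ℕP.m≤m+n _ (crossDegree i)) (ℕP.m≤m+n _ _))
      charged {i} (inj₂ (inj₁ 0<cross)) =
        ℕP.<-≤-trans 0<cross (ℕP.≤-trans (ℕP.m≤n+m (crossDegree i) (indicator (unmatchedInnerᵇ i))) (ℕP.m≤m+n _ _))
      charged {i} (inj₂ (inj₂ toV)) =
        ℕP.<-≤-trans (indicator-pos (dec-true (matchedToV? i) toV)) (ℕP.m≤n+m _ _)

  unmatchedᵇ : Fin n → Bool
  unmatchedᵇ i = does (unmatched? i)

  count-unmatched : count unmatchedᵇ + (length M + length M) ≡ n
  count-unmatched = begin
    count unmatchedᵇ + (length M + length M)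
      ≡⟨ cong (count unmatchedᵇ +_)
              (trans (count-∈ (matchedVertices G M) (proj₂ matching)) (length-matchedVertices G M)) ⟨
    count unmatchedᵇ + count (λ i → does (i ∈? matchedVertices G M))
      ≡⟨ ℕP.+-comm (count unmatchedᵇ) _ ⟩
    count (λ i → does (i ∈? matchedVertices G M)) + count unmatchedᵇ
      ≡⟨ count-not (λ i → does (i ∈? matchedVertices G M)) ⟩
    n ∎
    where open ≡-Reasoning

  u-unmatched : ∀ {w} → MatchedToV w → Unmatched u
  u-unmatched (w≢u , wv) u∈ with matched⇒matchEdge G M u∈
  ... | j , uj with u-pendant (matchEdge⇒Edge G matching uj)
  ...   | refl = w≢u (matchEdge-unique G M (proj₂ matching) wv uj)

  count-unmatchedInner+matchedToV : count unmatchedInnerᵇ + count matchedToVᵇ ≤ count unmatchedᵇ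
  count-unmatchedInner+matchedToV with FinP.any? matchedToV?
  ... | no ∄toV = begin
    count unmatchedInnerᵇ + count matchedToVᵇ
      ≡⟨ cong (count unmatchedInnerᵇ +_)
              (trans (count-cong λ i → dec-false (matchedToV? i) (∄toV ∘ (i ,_))) (count-false n)) ⟩
    count unmatchedInnerᵇ + 0
      ≡⟨ ℕP.+-identityʳ _ ⟩
    count unmatchedInnerᵇ
      ≤⟨ count-mono {f = unmatchedInnerᵇ} (λ i → ∧-conicalˡ _ _) ⟩
    count unmatchedᵇ ∎
    where open ℕP.≤-Reasoning
  ... | yes (w , toV) = begin
    count unmatchedInnerᵇ + count matchedToVᵇ
      ≤⟨ ℕP.+-monoʳ-≤ (count unmatchedInnerᵇ) (count-≤1 matchedToVᵇ λ i j toV-i toV-j →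
           matchEdge-unique G M (proj₂ matching) (proj₂ (does-true⇒ (matchedToV? i) toV-i))
                                                 (proj₂ (does-true⇒ (matchedToV? j) toV-j))) ⟩
    count unmatchedInnerᵇ + 1
      ≡⟨ ℕP.+-comm (count unmatchedInnerᵇ) 1 ⟩
    suc (count unmatchedInnerᵇ)
      ≤⟨ count-< {f = unmatchedInnerᵇ} u (λ i → ∧-conicalˡ _ _)
                   (dec-false (unmatched? u ×-dec inner? u) λ (_ , u≢u , _) → u≢u refl)
                   (dec-true (unmatched? u) (u-unmatched toV)) ⟩
    count unmatchedᵇ ∎
    where open ℕP.≤-Reasoning

  treeDegree nonTreeDegree : Fin n → ℕ
  treeDegree    i = count (λ j → does (treeEdge? i j))
  nonTreeDegree i = count (λ j → adj G i j ∧ not (does (treeEdge? i j)))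

  treeEdge-Edge : ∀ {i j} → TreeEdge i j → Edge G i j
  treeEdge-Edge (inj₁ i→j) = parent-Edge i→j
  treeEdge-Edge (inj₂ j→i) = edge-sym G (parent-Edge j→i)

  treeEdge-avoids : ∀ {i j} → TreeEdge i j → ¬ SameEdge i j
  treeEdge-avoids (inj₁ i→j) = ⟶⁻-avoids (parent-edge i→j)
  treeEdge-avoids (inj₂ j→i) = ⟶⁻-avoids (parent-edge j→i) ∘ sameEdge-sym

  v≢y : v ≢ y
  v≢y refl = contradiction (trans (sym vy) (irrefl G v)) λ ()

  crossDegree-+vy : ∀ i →
    crossDegree i + indicator (does (i FinP.≟ v)) + indicator (does (i FinP.≟ y)) ≤ nonTreeDegree i
  crossDegree-+vy i = by (i FinP.≟ v) (i FinP.≟ y)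
    where
      cross⊆nonTree : ∀ {i} j → does (crossEdge? i j) ≡ true → adj G i j ∧ not (does (treeEdge? i j)) ≡ true
      cross⊆nonTree {i} j cross with does-true⇒ (crossEdge? i j) cross
      ... | _ , _ , ij , ¬tree = cong₂ _∧_ ij (cong not (dec-false (treeEdge? i j) ¬tree))

      nonTree : ∀ {a b} → SameEdge a b → Edge G a b → adj G a b ∧ not (does (treeEdge? a b)) ≡ true
      nonTree {a} {b} same ab = cong₂ _∧_ ab (cong not (dec-false (treeEdge? a b) λ t → treeEdge-avoids t same))

      by : Dec (i ≡ v) → Dec (i ≡ y) →
           crossDegree i + indicator (does (i FinP.≟ v)) + indicator (does (i FinP.≟ y)) ≤ nonTreeDegree i
      shape : ∀ {a b} → does (i FinP.≟ v) ≡ a → does (i FinP.≟ y) ≡ b →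
              crossDegree i + indicator (does (i FinP.≟ v)) + indicator (does (i FinP.≟ y)) ≡
              crossDegree i + indicator a + indicator b
      shape = cong₂ (λ a b → crossDegree i + indicator a + indicator b)

      by (yes refl) _ = subst (_≤ nonTreeDegree i)
        (sym (trans (shape (dec-true (i FinP.≟ v) refl) (dec-false (i FinP.≟ y) v≢y))
                    (trans (ℕP.+-identityʳ _) (ℕP.+-comm _ 1))))
        (count-< y cross⊆nonTree (dec-false (crossEdge? i y) λ ((_ , v≢v) , _) → v≢v refl)
                                 (nonTree (inj₁ (refl , refl)) vy))
      by (no i≢v) (yes refl) = subst (_≤ nonTreeDegree i)
        (sym (trans (shape (dec-false (i FinP.≟ v) i≢v) (dec-true (i FinP.≟ y) refl))
                    (trans (cong (_+ 1) (ℕP.+-identityʳ _)) (ℕP.+-comm _ 1))))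
        (count-< v cross⊆nonTree (dec-false (crossEdge? i v) λ (_ , (_ , v≢v) , _) → v≢v refl)
                                 (nonTree (inj₂ (refl , refl)) (edge-sym G vy)))
      by (no i≢v) (no i≢y) = subst (_≤ nonTreeDegree i)
        (sym (trans (shape (dec-false (i FinP.≟ v) i≢v) (dec-false (i FinP.≟ y) i≢y))
                    (trans (ℕP.+-identityʳ _) (ℕP.+-identityʳ _))))
        (count-mono cross⊆nonTree)

  crossDegree-sum : ℕ∑.sum crossDegree + 2 ≤ ℕ∑.sum nonTreeDegree
  crossDegree-sum = begin
    ℕ∑.sum crossDegree + 2
      ≡⟨ ℕP.+-assoc (ℕ∑.sum crossDegree) 1 1 ⟨
    ℕ∑.sum crossDegree + 1 + 1
      ≡⟨ cong₂ (λ a b → ℕ∑.sum crossDegree + a + b) (count-≟ v) (count-≟ y) ⟨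
    ℕ∑.sum crossDegree + count (λ i → does (i FinP.≟ v)) + count (λ i → does (i FinP.≟ y))
      ≡⟨ cong (_+ count (λ i → does (i FinP.≟ y))) (ℕ∑.∑-distrib-+ crossDegree _) ⟨
    ℕ∑.sum (λ i → crossDegree i + indicator (does (i FinP.≟ v))) + count (λ i → does (i FinP.≟ y))
      ≡⟨ ℕ∑.∑-distrib-+ (λ i → crossDegree i + indicator (does (i FinP.≟ v))) _ ⟨
    ℕ∑.sum (λ i → crossDegree i + indicator (does (i FinP.≟ v)) + indicator (does (i FinP.≟ y)))
      ≤⟨ sum-mono-≤ crossDegree-+vy ⟩
    ℕ∑.sum nonTreeDegree ∎
    where open ℕP.≤-Reasoning

  degree-split : ∀ i → count (adj G i) ≡ treeDegree i + nonTreeDegree i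
  degree-split i = trans (count-split (adj G i) (λ j → does (treeEdge? i j)))
                         (cong (_+ nonTreeDegree i) (count-cong tree⊆adj))
    where
      tree⊆adj : ∀ j → adj G i j ∧ does (treeEdge? i j) ≡ does (treeEdge? i j)
      tree⊆adj j = by (treeEdge? i j)
        where
          by : (tree? : Dec (TreeEdge i j)) → adj G i j ∧ does tree? ≡ does tree?
          by (yes tree) = cong (_∧ true) (treeEdge-Edge tree)
          by (no  _)    = ∧-zeroʳ (adj G i j)

  hasParentᵇ : Fin n → Bool
  hasParentᵇ i = Maybe.is-just (parent i)

  count-parent : ∀ i → count (λ j → does (parent i ≟ₘ just j)) ≡ indicator (hasParentᵇ i)
  count-parent i with parent i
  ... | nothing = count-false n
  ... | just p  = trans (count-cong λ j → does-⇔ (mk⇔ sym sym) (p FinP.≟ j) (j FinP.≟ p)) (count-≟ p)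

  treeDegree-sum : ℕ∑.sum treeDegree ≡ count hasParentᵇ + count hasParentᵇ
  treeDegree-sum = begin
    ℕ∑.sum treeDegree
      ≡⟨ ℕ∑.sum-cong-≗ (λ i → count-∨-disjoint (up i) (down i) (λ j i→j → dec-false (parent j ≟ₘ just i)
                                  (parent-acyclic (does-true⇒ (parent i ≟ₘ just j) i→j)))) ⟩
    ℕ∑.sum (λ i → count (up i) + count (down i))
      ≡⟨ ℕ∑.∑-distrib-+ (count ∘ up) (count ∘ down) ⟩
    ℕ∑.sum (count ∘ up) + ℕ∑.sum (count ∘ down)
      ≡⟨ cong (ℕ∑.sum (count ∘ up) +_) (ℕ∑.∑-comm (λ i j → indicator (down i j))) ⟩
    ℕ∑.sum (count ∘ up) + ℕ∑.sum (count ∘ up)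
      ≡⟨ cong₂ _+_ (ℕ∑.sum-cong-≗ count-parent) (ℕ∑.sum-cong-≗ count-parent) ⟩
    count hasParentᵇ + count hasParentᵇ ∎
    where
      open ≡-Reasoning
      up down : Fin n → Fin n → Bool
      up   i j = does (parent i ≟ₘ just j)
      down i j = does (parent j ≟ₘ just i)

  count-orphans : Unique roots → count (not ∘ hasParentᵇ) ≤ length roots
  count-orphans !roots = ℕP.≤-trans (count-mono orphan∈roots) (ℕP.≤-reflexive (count-∈ roots !roots))
    where
      orphan∈roots : ∀ i → not (hasParentᵇ i) ≡ true → does (i ∈? roots) ≡ true
      orphan∈roots i _ with parent i in no-parent
      ... | nothing = dec-true (i ∈? roots) (orphan-root no-parent)

  tree+nonTree : count hasParentᵇ + count hasParentᵇ + ℕ∑.sum nonTreeDegree ≡ edgeCount G + edgeCount G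
  tree+nonTree = begin
    count hasParentᵇ + count hasParentᵇ + ℕ∑.sum nonTreeDegree
      ≡⟨ cong (_+ ℕ∑.sum nonTreeDegree) treeDegree-sum ⟨
    ℕ∑.sum treeDegree + ℕ∑.sum nonTreeDegree
      ≡⟨ ℕ∑.∑-distrib-+ treeDegree nonTreeDegree ⟨
    ℕ∑.sum (λ i → treeDegree i + nonTreeDegree i)
      ≡⟨ ℕ∑.sum-cong-≗ degree-split ⟨
    ℕ∑.sum (λ i → count (adj G i))
      ≡⟨ degree-sum G ⟩
    edgeCount G + edgeCount G ∎
    where open ≡-Reasoning

  nullity-bound : ∀ {η} → IsNullity G η → Unique roots →
                  η + 2 + (length M + length M) + (n + n) ≤
                  n + (edgeCount G + edgeCount G) + (length roots + length roots)
  nullity-bound {η} nullity !roots = begin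
    η + 2 + 2m + (n + n)
      ≤⟨ ℕP.+-monoˡ-≤ (n + n) (ℕP.+-monoˡ-≤ 2m (ℕP.+-monoˡ-≤ 2
           (ℕP.≤-trans (nullity≤count G determiningᵇ nullity kernelDetermining) count-determining))) ⟩
    UI + X + MV + 2 + 2m + (n + n)
      ≡⟨ regroup₁ UI X MV 2m (n + n) ⟩
    (UI + MV) + (X + 2) + 2m + (n + n)
      ≤⟨ ℕP.+-monoˡ-≤ (n + n)
           (ℕP.+-monoˡ-≤ 2m (ℕP.+-mono-≤ count-unmatchedInner+matchedToV crossDegree-sum)) ⟩
    U + N + 2m + (n + n)
      ≡⟨ cong (λ k → U + N + 2m + (k + k)) (count-not hasParentᵇ) ⟨
    U + N + 2m + ((P + R) + (P + R))
      ≡⟨ regroup₂ U N 2m P R ⟩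
    (U + 2m) + (P + P + N) + (R + R)
      ≡⟨ cong₂ (λ a b → a + b + (R + R)) count-unmatched tree+nonTree ⟩
    n + (edgeCount G + edgeCount G) + (R + R)
      ≤⟨ ℕP.+-monoʳ-≤ (n + (edgeCount G + edgeCount G))
           (ℕP.+-mono-≤ (count-orphans !roots) (count-orphans !roots)) ⟩
    n + (edgeCount G + edgeCount G) + (length roots + length roots) ∎
    where
      open ℕP.≤-Reasoning
      2m = length M + length M
      UI = count unmatchedInnerᵇ
      MV = count matchedToVᵇ
      U  = count unmatchedᵇ
      X  = ℕ∑.sum crossDegree
      N  = ℕ∑.sum nonTreeDegree
      P  = count hasParentᵇ
      R  = count (not ∘ hasParentᵇ)
      regroup₁ : ∀ a b c d e → a + b + c + 2 + d + e ≡ (a + c) + (b + 2) + d + e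
      regroup₁ = solve-∀
      regroup₂ : ∀ a b c d e → a + b + c + ((d + e) + (d + e)) ≡ (a + c) + (d + d + b) + (e + e)
      regroup₂ = solve-∀

open import Data.Integer as ℤ using (ℤ; +_; _+_; _-_; _*_; _≤_)
import Data.Integer.Properties as ℤP
import Data.Integer.Tactic.RingSolver as ℤSolver

ℕ-bound⇒ℤ-bound : ∀ {η n m e θ} →
                  η ℕ.+ 2 ℕ.+ (m ℕ.+ m) ℕ.+ (n ℕ.+ n) ℕ.≤ n ℕ.+ (e ℕ.+ e) ℕ.+ (θ ℕ.+ θ) →
                  + η ≤ + n - + 2 * + m + + 2 * (+ e - + n + + θ) - + 2
ℕ-bound⇒ℤ-bound {η} {n} {m} {e} {θ} a≤b = begin
  + η
    ≤⟨ ℤ.+≤+ (ℕP.m≤m+n η slack) ⟩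
  + η + + slack
    ≡⟨ cancel (+ η) (+ slack) (+ m) (+ n) ⟨
  (+ a + + slack) - (+ 2 + (+ m + + m) + (+ n + + n))
    ≡⟨ cong (λ k → + k - (+ 2 + (+ m + + m) + (+ n + + n))) (ℕP.m+[n∸m]≡n a≤b) ⟩
  + b - (+ 2 + (+ m + + m) + (+ n + + n))
    ≡⟨ expand (+ n) (+ m) (+ e) (+ θ) ⟨
  + n - + 2 * + m + + 2 * (+ e - + n + + θ) - + 2 ∎
  where
    open ℤP.≤-Reasoning
    a b slack : ℕ
    a = η ℕ.+ 2 ℕ.+ (m ℕ.+ m) ℕ.+ (n ℕ.+ n)
    b = n ℕ.+ (e ℕ.+ e) ℕ.+ (θ ℕ.+ θ)
    slack = b ℕ.∸ a
    cancel : ∀ h k m n → (h + + 2 + (m + m) + (n + n) + k) - (+ 2 + (m + m) + (n + n)) ≡ h + k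
    cancel = ℤSolver.solve-∀
    expand : ∀ n m e θ → n - + 2 * m + + 2 * (e - n + θ) - + 2 ≡
                         (n + (e + e) + (θ + θ)) - (+ 2 + (m + m) + (n + n))
    expand = ℤSolver.solve-∀

lemma4p2 : (n : ℕ) (G : SignedGraph n) (u v : Fin n) (η m θ : ℕ) →
    Unbalanced G → Pendant G u → Edge G u v → OnCycle G v →
    IsNullity G η → IsMatchingNumber G m → IsComponentCount G θ →
    + η ≤ + n - + 2 * + m + + 2 * (+ edgeCount G - + n + + θ) - + 2
lemma4p2 n G u v η _ _ _ pendant uv onCycle nullity ((M , matching , refl) , _) (roots , refl , !roots , _ , covered)
  with cycle-detour G onCycle
... | y , vy , detour =
  ℕ-bound⇒ℤ-bound {η} {n} {length M} {edgeCount G} {length roots}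
    (DeterminingSet.nullity-bound G (pendant-neighbour G pendant uv) uv vy forest matching nullity !roots)
  where
    open WithoutEdge G v y using (adj⁻; walk⁻)
    forest : RootedForest adj⁻ roots
    forest = BreadthFirst.spanningForest adj⁻ roots λ i →
      let r , r∈ , walk = covered i in r , r∈ , walk⁻ detour walk
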